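{- Let $X$ and $Y$ be coloured linear orders with $Y$ non-empty and $X\preccurlyeq X+Y$. Then $X\preccurlyeq X+\sum_{\zeta}Y$, where $\sum_\zeta Y$ is the sum of $\mathbb{Z}$-indexed copies of $Y$.
   Context: A coloured linear order is a structure in a language $\{<\}\cup\{\chi_\alpha:\alpha<\lambda\}$ with $<$ a linear order and the $\chi_\alpha$ unary predicates. For coloured linear orders $X,Y$, $X+Y$ is the disjoint union with the orders of $X$ and $Y$ and every element of $X$ below every element of $Y$, colours inherited. For a linear order $I$, $\sum_I Y$ is the disjoint union of copies $Y_i$ ($i\in I$) of $Y$, ordered so that $Y_i$ lies below $Y_j$ for $i<j$ and each copy ordered as $Y$, colours inherited; $\zeta$ is the order type of $\mathbb{Z}$. $\preccurlyeq$ denotes elementary substructure with $X$ identified with its copy in the sum. -}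

module Defs where

open import Data.Nat using (ℕ; suc)
open import Data.Fin using (Fin; zero; suc)
open import Data.Integer using (ℤ) renaming (_<_ to _<ℤ_)
open import Data.Product using (Σ; _×_; _,_; proj₁; proj₂)
open import Data.Sum using (_⊎_; inj₁; inj₂)
open import Data.Empty using (⊥)
open import Data.Unit using (⊤)
open import Relation.Nullary using (¬_)
open import Relation.Binary.PropositionalEquality using (_≡_)
open import Function using (_∘_)
open import Relation.Binary.Definitions using (tri<; tri≈; tri>)

record CLO (Λ : Set) : Set₁ where
  field
    Carrier : Set
    _≺_     : Carrier → Carrier → Set
    χ       : Λ → Carrier → Set
    irrefl  : ∀ x → ¬ (x ≺ x)
    trans   : ∀ {x y z} → x ≺ y → y ≺ z → x ≺ z
    total   : ∀ x y → (x ≺ y) ⊎ (x ≡ y) ⊎ (y ≺ x)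
open CLO public

data Formula (Λ : Set) : ℕ → Set where
  _≐_  : ∀ {n} → Fin n → Fin n → Formula Λ n
  _≺'_ : ∀ {n} → Fin n → Fin n → Formula Λ n
  col  : ∀ {n} → Λ → Fin n → Formula Λ n
  ⊥'   : ∀ {n} → Formula Λ n
  ¬'_  : ∀ {n} → Formula Λ n → Formula Λ n
  _∧'_ : ∀ {n} → Formula Λ n → Formula Λ n → Formula Λ n
  _∨'_ : ∀ {n} → Formula Λ n → Formula Λ n → Formula Λ n
  _⇒'_ : ∀ {n} → Formula Λ n → Formula Λ n → Formula Λ n
  ∀'   : ∀ {n} → Formula Λ (suc n) → Formula Λ n
  ∃'   : ∀ {n} → Formula Λ (suc n) → Formula Λ n

_∷ₐ_ : ∀ {A : Set} {n} → A → (Fin n → A) → Fin (suc n) → A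
(a ∷ₐ ρ) zero    = a
(a ∷ₐ ρ) (suc i) = ρ i

Sat : ∀ {Λ} (M : CLO Λ) {n} → Formula Λ n → (Fin n → Carrier M) → Set
Sat M (i ≐ j)   ρ = ρ i ≡ ρ j
Sat M (i ≺' j)  ρ = _≺_ M (ρ i) (ρ j)
Sat M (col α i) ρ = χ M α (ρ i)
Sat M ⊥'        ρ = ⊥
Sat M (¬' φ)    ρ = ¬ Sat M φ ρ
Sat M (φ ∧' ψ)  ρ = Sat M φ ρ × Sat M ψ ρ
Sat M (φ ∨' ψ)  ρ = Sat M φ ρ ⊎ Sat M ψ ρ
Sat M (φ ⇒' ψ)  ρ = Sat M φ ρ → Sat M ψ ρ
Sat M (∀' φ)    ρ = (a : Carrier M) → Sat M φ (a ∷ₐ ρ)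
Sat M (∃' φ)    ρ = Σ (Carrier M) λ a → Sat M φ (a ∷ₐ ρ)

Elementary : ∀ {Λ} (M N : CLO Λ) → (Carrier M → Carrier N) → Set
Elementary {Λ} M N f =
  ∀ {n} (φ : Formula Λ n) (ρ : Fin n → Carrier M) →
    (Sat M φ ρ → Sat N φ (f ∘ ρ)) × (Sat N φ (f ∘ ρ) → Sat M φ ρ)

_⊕_ : ∀ {Λ} → CLO Λ → CLO Λ → CLO Λ
_⊕_ {Λ} X Y = record
  { Carrier = Carrier X ⊎ Carrier Y
  ; _≺_ = lt
  ; χ = c
  ; irrefl = irr
  ; trans = λ {x} {y} {z} → tr {x} {y} {z}
  ; total = tot
  }
  where
  lt : Carrier X ⊎ Carrier Y → Carrier X ⊎ Carrier Y → Set
  lt (inj₁ a) (inj₁ b) = _≺_ X a b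
  lt (inj₁ a) (inj₂ b) = ⊤
  lt (inj₂ a) (inj₁ b) = ⊥
  lt (inj₂ a) (inj₂ b) = _≺_ Y a b
  c : Λ → Carrier X ⊎ Carrier Y → Set
  c α (inj₁ a) = χ X α a
  c α (inj₂ b) = χ Y α b
  irr : ∀ x → ¬ lt x x
  irr (inj₁ a) = irrefl X a
  irr (inj₂ b) = irrefl Y b
  tr : ∀ {x y z} → lt x y → lt y z → lt x z
  tr {inj₁ _} {inj₁ _} {inj₁ _} p q = trans X p q
  tr {inj₁ _} {inj₁ _} {inj₂ _} p q = _
  tr {inj₁ _} {inj₂ _} {inj₂ _} p q = _
  tr {inj₂ _} {inj₂ _} {inj₂ _} p q = trans Y p q
  tr {inj₁ _} {inj₂ _} {inj₁ _} p ()
  tr {inj₂ _} {inj₁ _} {_} () q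
  tr {inj₂ _} {inj₂ _} {inj₁ _} p ()
  tot : ∀ x y → lt x y ⊎ (x ≡ y) ⊎ lt y x
  tot (inj₁ a) (inj₁ b) with total X a b
  ... | inj₁ p = inj₁ p
  ... | inj₂ (inj₁ Relation.Binary.PropositionalEquality.refl) = inj₂ (inj₁ Relation.Binary.PropositionalEquality.refl)
  ... | inj₂ (inj₂ p) = inj₂ (inj₂ p)
  tot (inj₁ a) (inj₂ b) = inj₁ _
  tot (inj₂ a) (inj₁ b) = inj₂ (inj₂ _)
  tot (inj₂ a) (inj₂ b) with total Y a b
  ... | inj₁ p = inj₁ p
  ... | inj₂ (inj₁ Relation.Binary.PropositionalEquality.refl) = inj₂ (inj₁ Relation.Binary.PropositionalEquality.refl)
  ... | inj₂ (inj₂ p) = inj₂ (inj₂ p)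

Σζ : ∀ {Λ} → CLO Λ → CLO Λ
Σζ {Λ} Y = record
  { Carrier = ℤ × Carrier Y
  ; _≺_ = lt
  ; χ = λ α p → χ Y α (proj₂ p)
  ; irrefl = irr
  ; trans = λ {x} {y} {z} → tr {x} {y} {z}
  ; total = tot
  }
  where
  open import Data.Integer.Properties as ℤP using ()
  open import Relation.Binary.PropositionalEquality using (refl)
  lt : ℤ × Carrier Y → ℤ × Carrier Y → Set
  lt (i , a) (j , b) = (i <ℤ j) ⊎ ((i ≡ j) × _≺_ Y a b)
  irr : ∀ x → ¬ lt x x
  irr (i , a) (inj₁ p) = ℤP.<-irrefl refl p
  irr (i , a) (inj₂ (_ , p)) = irrefl Y a p
  tr : ∀ {x y z} → lt x y → lt y z → lt x z
  tr (inj₁ p) (inj₁ q) = inj₁ (ℤP.<-trans p q)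
  tr (inj₁ p) (inj₂ (refl , _)) = inj₁ p
  tr (inj₂ (refl , _)) (inj₁ q) = inj₁ q
  tr (inj₂ (refl , p)) (inj₂ (refl , q)) = inj₂ (refl , trans Y p q)
  tot : ∀ x y → lt x y ⊎ (x ≡ y) ⊎ lt y x
  tot (i , a) (j , b) with ℤP.<-cmp i j
  ... | tri< p _ _ = inj₁ (inj₁ p)
  ... | tri> _ _ p = inj₂ (inj₂ (inj₁ p))
  ... | tri≈ _ refl _ with total Y a b
  ...   | inj₁ p = inj₁ (inj₂ (refl , p))
  ...   | inj₂ (inj₁ refl) = inj₂ (inj₁ refl)
  ...   | inj₂ (inj₂ p) = inj₂ (inj₂ (inj₂ (refl , p)))

module Submission where

-- Elementarity is captured by Ehrenfeucht–Fraïssé games restricted to finitely many colours: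
-- Duplicator wins the k-round game between X and X + Y from (ρ, ρ), because the rank-k Hintikka
-- formula of ρ transfers along X ≼ X + Y (this step uses excluded middle). Games compose along
-- sums, so a strategy against X + (Y₋ₘ + … + Yₘ₋₁) yields one against X + Y + (Y₋ₘ + … + Yₘ₋₁) + Y,
-- i.e. against the next larger window of Σ_ζ Y, with the same positions inside X + Σ_ζ Y.
-- Against X + Σ_ζ Y Duplicator therefore plays within a finite window and widens it whenever
-- Spoiler moves outside.

open import Defs
open import Level using (0ℓ)
open import Axiom.ExcludedMiddle using (ExcludedMiddle)
open import Data.Nat using (ℕ; zero; suc; _<_; _≤_; z≤n; s≤s; _⊔_)
import Data.Nat.Properties as ℕ
open import Data.Integer using (ℤ; +_; -[1+_]) renaming (_<_ to _<ℤ_)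
open import Data.Integer.Base using (-<-; -<+; +<+)
import Data.Integer.Properties as ℤ
open import Data.Fin using (Fin; zero; suc)
open import Data.Maybe using (Maybe; just; nothing; _>>=_; fromMaybe) renaming (map to mapᵐ)
open import Data.Product using (∃; _×_; _,_; proj₁; proj₂; uncurry)
open import Data.Sum using (_⊎_; inj₁; inj₂; isInj₁; isInj₂; map₁; map₂)
open import Data.Sum.Properties using (inj₁-injective; inj₂-injective)
open import Data.Empty using (⊥; ⊥-elim)
open import Data.Unit using (tt)
open import Data.List using (List; []; _∷_; _++_; map; filter; cartesianProduct; allFin)
open import Data.Bool using (true; false)
open import Data.List.Membership.Propositional using (_∈_)
open import Data.List.Relation.Binary.Subset.Propositional using (_⊆_)
open import Data.List.Relation.Binary.Subset.Propositional.Properties using (⊆-refl)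
open import Data.List.Membership.Propositional.Properties
  using (∈-++⁺ˡ; ∈-++⁺ʳ; ∈-++⁻; ∈-map⁺; ∈-map⁻; ∈-filter⁺; ∈-filter⁻; ∈-cartesianProduct⁺; ∈-cartesianProduct⁻; ∈-allFin)
open import Data.List.Relation.Unary.Any using (here; there)
open import Data.Product.Function.NonDependent.Propositional using (_×-⇔_)
open import Data.Sum.Function.Propositional using (_⊎-⇔_)
open import Function using (_∘_)
open import Function.Related.TypeIsomorphisms using (¬-cong-⇔; →-cong-⇔)
open import Function.Bundles using (_⇔_; mk⇔; Equivalence)
open import Function.Construct.Identity using (⇔-id)
open import Function.Properties.Equivalence using () renaming (trans to ⇔-trans)
open import Relation.Nullary using (¬_; yes; no; does)
open import Relation.Unary using (Decidable)
open import Relation.Binary.PropositionalEquality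
  using (_≡_; refl; sym; cong; cong₂; subst; _≗_)
  renaming (trans to ≡-trans)

private
  ≡⇒⇔ : {A B : Set} → A ≡ B → A ⇔ B
  ≡⇒⇔ refl = ⇔-id _

  ⊥⇔⊥ : {A B : Set} → ¬ A → ¬ B → A ⇔ B
  ⊥⇔⊥ ¬a ¬b = mk⇔ (⊥-elim ∘ ¬a) (⊥-elim ∘ ¬b)

LiftRel : {A B : Set} → (A → B → Set) → Maybe A → Maybe B → Set
LiftRel R (just a) (just b) = R a b
LiftRel R _        _        = ⊥

LiftPred : {A : Set} → (A → Set) → Maybe A → Set
LiftPred P (just a) = P a
LiftPred P nothing  = ⊥

LiftRel-nothingʳ : {A B : Set} {R : A → B → Set} (x : Maybe A) → ¬ LiftRel R x nothing
LiftRel-nothingʳ (just _) ()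
LiftRel-nothingʳ nothing  ()

LiftRel-map : {A B A′ B′ : Set} {R : A → B → Set} {R′ : A′ → B′ → Set} {f : A → A′} {g : B → B′} →
  (∀ a b → R a b ⇔ R′ (f a) (g b)) → ∀ x y → LiftRel R x y ⇔ LiftRel R′ (mapᵐ f x) (mapᵐ g y)
LiftRel-map R⇔R′ (just a) (just b) = R⇔R′ a b
LiftRel-map R⇔R′ (just a) nothing  = ⇔-id _
LiftRel-map R⇔R′ nothing  y        = ⇔-id _

LiftPred-map : {A A′ : Set} {P : A → Set} {P′ : A′ → Set} {f : A → A′} →
  (∀ a → P a ⇔ P′ (f a)) → ∀ x → LiftPred P x ⇔ LiftPred P′ (mapᵐ f x)
LiftPred-map P⇔P′ (just a) = P⇔P′ a
LiftPred-map P⇔P′ nothing  = ⇔-id _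

∘-∷ₐ : {A B : Set} {n : ℕ} (f : A → B) (x : A) (v : Fin n → A) → f ∘ (x ∷ₐ v) ≗ (f x ∷ₐ (f ∘ v))
∘-∷ₐ f x v zero    = refl
∘-∷ₐ f x v (suc i) = refl

_∷-≗_ : {A : Set} {n : ℕ} {v v′ : Fin n → A} (x : A) → v ≗ v′ → (x ∷ₐ v) ≗ (x ∷ₐ v′)
(x ∷-≗ v≗v′) zero    = refl
(x ∷-≗ v≗v′) (suc i) = v≗v′ i

-- Assignments may leave variables undefined: restricting an assignment into
-- A ⊕ C to its A-part leaves gaps where it takes values in C.
Assignment : {Λ : Set} → CLO Λ → ℕ → Set
Assignment M n = Fin n → Maybe (Carrier M)

reindex : {A : Set} {m n : ℕ} → (Fin m → Maybe (Fin n)) → (Fin n → Maybe A) → Fin m → Maybe A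
reindex π v i = π i >>= v

lift : {m n : ℕ} → (Fin m → Maybe (Fin n)) → Fin (suc m) → Maybe (Fin (suc n))
lift π zero    = just zero
lift π (suc i) = mapᵐ suc (π i)

reindex-lift : {A : Set} {m n : ℕ} (π : Fin m → Maybe (Fin n)) (x : Maybe A) (v : Fin n → Maybe A) →
  reindex (lift π) (x ∷ₐ v) ≗ (x ∷ₐ reindex π v)
reindex-lift π x v zero = refl
reindex-lift π x v (suc i) with π i
... | nothing = refl
... | just _  = refl

LiftRel-reindex : {A B : Set} {R : A → A → Set} {R′ : B → B → Set} {n : ℕ}
  {v : Fin n → Maybe A} {w : Fin n → Maybe B} →
  (∀ i j → LiftRel R (v i) (v j) ⇔ LiftRel R′ (w i) (w j)) →
  ∀ p q → LiftRel R (p >>= v) (q >>= v) ⇔ LiftRel R′ (p >>= w) (q >>= w)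
LiftRel-reindex agree (just i) (just j) = agree i j
LiftRel-reindex {v = v} {w} agree (just i) nothing  =
  ⊥⇔⊥ (LiftRel-nothingʳ (v i)) (LiftRel-nothingʳ (w i))
LiftRel-reindex agree nothing q = ⇔-id _

LiftPred-reindex : {A B : Set} {P : A → Set} {P′ : B → Set} {n : ℕ}
  {v : Fin n → Maybe A} {w : Fin n → Maybe B} →
  (∀ i → LiftPred P (v i) ⇔ LiftPred P′ (w i)) → ∀ p → LiftPred P (p >>= v) ⇔ LiftPred P′ (p >>= w)
LiftPred-reindex agree (just i) = agree i
LiftPred-reindex agree nothing  = ⇔-id _

left : {A C : Set} {n : ℕ} → (Fin n → Maybe (A ⊎ C)) → Fin n → Maybe A
left v i = v i >>= isInj₁

right : {A C : Set} {n : ℕ} → (Fin n → Maybe (A ⊎ C)) → Fin n → Maybe C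
right v i = v i >>= isInj₂

data SameSide {A B C D : Set} : Maybe (A ⊎ C) → Maybe (B ⊎ D) → Set where
  undefined : SameSide nothing nothing
  onLeft    : ∀ a b → SameSide (just (inj₁ a)) (just (inj₁ b))
  onRight   : ∀ c d → SameSide (just (inj₂ c)) (just (inj₂ d))

sameSide : {A B C D : Set} (x : Maybe (A ⊎ C)) (y : Maybe (B ⊎ D)) →
  LiftRel _≡_ (x >>= isInj₁) (x >>= isInj₁) ⇔ LiftRel _≡_ (y >>= isInj₁) (y >>= isInj₁) →
  LiftRel _≡_ (x >>= isInj₂) (x >>= isInj₂) ⇔ LiftRel _≡_ (y >>= isInj₂) (y >>= isInj₂) →
  SameSide x y
sameSide nothing           nothing           _ _ = undefined
sameSide (just (inj₁ a))   (just (inj₁ b))   _ _ = onLeft a b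
sameSide (just (inj₂ c))   (just (inj₂ d))   _ _ = onRight c d
sameSide nothing           (just (inj₁ _))   l _ = ⊥-elim (Equivalence.from l refl)
sameSide nothing           (just (inj₂ _))   _ r = ⊥-elim (Equivalence.from r refl)
sameSide (just (inj₁ _))   nothing           l _ = ⊥-elim (Equivalence.to l refl)
sameSide (just (inj₁ _))   (just (inj₂ _))   l _ = ⊥-elim (Equivalence.to l refl)
sameSide (just (inj₂ _))   nothing           _ r = ⊥-elim (Equivalence.to r refl)
sameSide (just (inj₂ _))   (just (inj₁ _))   _ r = ⊥-elim (Equivalence.to r refl)

quantifierDepth : {Λ : Set} {n : ℕ} → Formula Λ n → ℕ
quantifierDepth (_ ≐ _)   = 0
quantifierDepth (_ ≺' _)  = 0
quantifierDepth (col _ _) = 0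
quantifierDepth ⊥'        = 0
quantifierDepth (¬' φ)    = quantifierDepth φ
quantifierDepth (φ ∧' ψ)  = quantifierDepth φ ⊔ quantifierDepth ψ
quantifierDepth (φ ∨' ψ)  = quantifierDepth φ ⊔ quantifierDepth ψ
quantifierDepth (φ ⇒' ψ)  = quantifierDepth φ ⊔ quantifierDepth ψ
quantifierDepth (∀' φ)    = suc (quantifierDepth φ)
quantifierDepth (∃' φ)    = suc (quantifierDepth φ)

colours : {Λ : Set} {n : ℕ} → Formula Λ n → List Λ
colours (_ ≐ _)   = []
colours (_ ≺' _)  = []
colours (col α _) = α ∷ []
colours ⊥'        = []
colours (¬' φ)    = colours φ
colours (φ ∧' ψ)  = colours φ ++ colours ψ
colours (φ ∨' ψ)  = colours φ ++ colours ψ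
colours (φ ⇒' ψ)  = colours φ ++ colours ψ
colours (∀' φ)    = colours φ
colours (∃' φ)    = colours φ

sublists : {A : Set} → List A → List (List A)
sublists []       = [] ∷ []
sublists (x ∷ xs) = map (x ∷_) (sublists xs) ++ sublists xs

∈-sublists⇒⊆ : {A : Set} {xs S : List A} → S ∈ sublists xs → S ⊆ xs
∈-sublists⇒⊆ {xs = []}     (here refl) ()
∈-sublists⇒⊆ {xs = x ∷ xs} S∈ y∈S with ∈-++⁻ (map (x ∷_) (sublists xs)) S∈
... | inj₂ S∈′ = there (∈-sublists⇒⊆ S∈′ y∈S)
... | inj₁ S∈′ with ∈-map⁻ (x ∷_) S∈′
...   | S′ , S′∈ , refl with y∈S
...     | here y≡x   = here y≡x
...     | there y∈S′ = there (∈-sublists⇒⊆ S′∈ y∈S′)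

filter∈sublists : {A : Set} {P : A → Set} (P? : Decidable P) (xs : List A) → filter P? xs ∈ sublists xs
filter∈sublists P? []       = here refl
filter∈sublists P? (x ∷ xs) with does (P? x)
... | true  = ∈-++⁺ˡ (∈-map⁺ (x ∷_) (filter∈sublists P? xs))
... | false = ∈-++⁺ʳ (map (x ∷_) (sublists xs)) (filter∈sublists P? xs)

⊤' : {Λ : Set} {n : ℕ} → Formula Λ n
⊤' = ¬' ⊥'

⋀ : {Λ : Set} {n : ℕ} → List (Formula Λ n) → Formula Λ n
⋀ []       = ⊤'
⋀ (φ ∷ φs) = φ ∧' ⋀ φs

⋁ : {Λ : Set} {n : ℕ} → List (Formula Λ n) → Formula Λ n
⋁ []       = ⊥'
⋁ (φ ∷ φs) = φ ∨' ⋁ φs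

completeConjunctions : {Λ : Set} {n : ℕ} → List (Formula Λ n) → List (Formula Λ n)
completeConjunctions []       = ⊤' ∷ []
completeConjunctions (φ ∷ φs) =
  map (φ ∧'_) (completeConjunctions φs) ++ map ((¬' φ) ∧'_) (completeConjunctions φs)

module _ {Λ : Set} {M : CLO Λ} {n : ℕ} {ρ : Fin n → Carrier M} where

  ⋀-intro : ∀ φs → (∀ {φ} → φ ∈ φs → Sat M φ ρ) → Sat M (⋀ φs) ρ
  ⋀-intro []       _   = λ ()
  ⋀-intro (φ ∷ φs) sat = sat (here refl) , ⋀-intro φs (sat ∘ there)

  ⋀-elim : ∀ {φs φ} → Sat M (⋀ φs) ρ → φ ∈ φs → Sat M φ ρ
  ⋀-elim (s , _) (here refl) = s
  ⋀-elim (_ , s) (there φ∈) = ⋀-elim s φ∈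

  ⋁-intro : ∀ {φs φ} → φ ∈ φs → Sat M φ ρ → Sat M (⋁ φs) ρ
  ⋁-intro (here refl) s = inj₁ s
  ⋁-intro (there φ∈)  s = inj₂ (⋁-intro φ∈ s)

  ⋁-elim : ∀ φs → Sat M (⋁ φs) ρ → ∃ λ φ → φ ∈ φs × Sat M φ ρ
  ⋁-elim (φ ∷ φs) (inj₁ s) = φ , here refl , s
  ⋁-elim (φ ∷ φs) (inj₂ s) = let ψ , ψ∈ , t = ⋁-elim φs s in ψ , there ψ∈ , t

  completeConjunction-exists : ExcludedMiddle 0ℓ → ∀ φs → ∃ λ ψ → ψ ∈ completeConjunctions φs × Sat M ψ ρ
  completeConjunction-exists lem []       = ⊤' , here refl , λ ()
  completeConjunction-exists lem (φ ∷ φs) with completeConjunction-exists lem φs | lem {Sat M φ ρ}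
  ... | ψ , ψ∈ , s | yes sφ = φ ∧' ψ , ∈-++⁺ˡ (∈-map⁺ (φ ∧'_) ψ∈) , sφ , s
  ... | ψ , ψ∈ , s | no ¬sφ =
    (¬' φ) ∧' ψ , ∈-++⁺ʳ (map (φ ∧'_) (completeConjunctions φs)) (∈-map⁺ ((¬' φ) ∧'_) ψ∈) , ¬sφ , s

completeConjunction-agree : {Λ : Set} {M N : CLO Λ} {n : ℕ} {ρ : Fin n → Carrier M} {σ : Fin n → Carrier N} →
  ∀ φs {ψ} → ψ ∈ completeConjunctions φs → Sat M ψ ρ → Sat N ψ σ →
  ∀ {φ} → φ ∈ φs → Sat M φ ρ ⇔ Sat N φ σ
completeConjunction-agree (φ ∷ φs) ψ∈ sψ tψ φ′∈ with ∈-++⁻ (map (φ ∧'_) (completeConjunctions φs)) ψ∈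
... | inj₁ ψ∈⁺ with ∈-map⁻ _ ψ∈⁺ | φ′∈
...   | _ , _  , refl | here refl   = mk⇔ (λ _ → proj₁ tψ) (λ _ → proj₁ sψ)
...   | _ , θ∈ , refl | there φ′∈′ = completeConjunction-agree φs θ∈ (proj₂ sψ) (proj₂ tψ) φ′∈′
completeConjunction-agree (φ ∷ φs) ψ∈ sψ tψ φ′∈ | inj₂ ψ∈⁻ with ∈-map⁻ _ ψ∈⁻ | φ′∈
...   | _ , _  , refl | here refl   = ⊥⇔⊥ (proj₁ sψ) (proj₁ tψ)
...   | _ , θ∈ , refl | there φ′∈′ = completeConjunction-agree φs θ∈ (proj₂ sψ) (proj₂ tψ) φ′∈′

record Embedding {Λ : Set} (M N : CLO Λ) : Set where
  field
    to     : Carrier M → Carrier N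
    mono   : ∀ {a b} → _≺_ M a b → _≺_ N (to a) (to b)
    χ-pres : ∀ α a → χ M α a ⇔ χ N α (to a)

  reflects : ∀ a b → _≺_ N (to a) (to b) → _≺_ M a b
  reflects a b to-a≺to-b with total M a b
  ... | inj₁ a≺b        = a≺b
  ... | inj₂ (inj₁ refl) = ⊥-elim (irrefl N (to a) to-a≺to-b)
  ... | inj₂ (inj₂ b≺a) = ⊥-elim (irrefl N (to a) (trans N to-a≺to-b (mono b≺a)))

  injective : ∀ a b → to a ≡ to b → a ≡ b
  injective a b to-a≡to-b with total M a b
  ... | inj₁ a≺b        = ⊥-elim (irrefl N (to b) (subst (λ x → _≺_ N x (to b)) to-a≡to-b (mono a≺b)))
  ... | inj₂ (inj₁ a≡b) = a≡b
  ... | inj₂ (inj₂ b≺a) = ⊥-elim (irrefl N (to a) (subst (λ x → _≺_ N x (to a)) (sym to-a≡to-b) (mono b≺a)))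

⊕-embeddingʳ : {Λ : Set} {A C D : CLO Λ} → Embedding C D → Embedding (A ⊕ C) (A ⊕ D)
⊕-embeddingʳ {A = A} {C} {D} e = record { to = map₂ to ; mono = λ {a} {b} → mono′ a b ; χ-pres = χ-pres′ }
  where
  open Embedding e
  mono′ : ∀ a b → _≺_ (A ⊕ C) a b → _≺_ (A ⊕ D) (map₂ to a) (map₂ to b)
  mono′ (inj₁ _) (inj₁ _) a≺b = a≺b
  mono′ (inj₁ _) (inj₂ _) _   = tt
  mono′ (inj₂ _) (inj₂ _) c≺d = mono c≺d
  χ-pres′ : ∀ α a → χ (A ⊕ C) α a ⇔ χ (A ⊕ D) α (map₂ to a)
  χ-pres′ α (inj₁ _) = ⇔-id _
  χ-pres′ α (inj₂ c) = χ-pres α c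

inj₁-embedding : {Λ : Set} {A B : CLO Λ} → Embedding A (A ⊕ B)
inj₁-embedding = record { to = inj₁ ; mono = λ a≺b → a≺b ; χ-pres = λ _ _ → ⇔-id _ }

regroup : {A B C D : Set} → ((A ⊎ B) ⊎ C) ⊎ D → A ⊎ ((B ⊎ C) ⊎ D)
regroup (inj₁ (inj₁ (inj₁ a))) = inj₁ a
regroup (inj₁ (inj₁ (inj₂ b))) = inj₂ (inj₁ (inj₁ b))
regroup (inj₁ (inj₂ c))        = inj₂ (inj₁ (inj₂ c))
regroup (inj₂ d)               = inj₂ (inj₂ d)

regroup-embedding : {Λ : Set} {A B C D : CLO Λ} → Embedding (((A ⊕ B) ⊕ C) ⊕ D) (A ⊕ ((B ⊕ C) ⊕ D))
regroup-embedding {A = A} {B} {C} {D} = record { to = regroup ; mono = λ {a} {b} → mono a b ; χ-pres = χ-pres }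
  where
  mono : ∀ a b → _≺_ (((A ⊕ B) ⊕ C) ⊕ D) a b → _≺_ (A ⊕ ((B ⊕ C) ⊕ D)) (regroup a) (regroup b)
  mono (inj₁ (inj₁ (inj₁ _))) (inj₁ (inj₁ (inj₁ _))) a≺a′ = a≺a′
  mono (inj₁ (inj₁ (inj₁ _))) (inj₁ (inj₁ (inj₂ _))) _    = tt
  mono (inj₁ (inj₁ (inj₁ _))) (inj₁ (inj₂ _))        _    = tt
  mono (inj₁ (inj₁ (inj₁ _))) (inj₂ _)               _    = tt
  mono (inj₁ (inj₁ (inj₂ _))) (inj₁ (inj₁ (inj₂ _))) b≺b′ = b≺b′
  mono (inj₁ (inj₁ (inj₂ _))) (inj₁ (inj₂ _))        _    = tt
  mono (inj₁ (inj₁ (inj₂ _))) (inj₂ _)               _    = tt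
  mono (inj₁ (inj₂ _))        (inj₁ (inj₂ _))        c≺c′ = c≺c′
  mono (inj₁ (inj₂ _))        (inj₂ _)               _    = tt
  mono (inj₂ _)               (inj₂ _)               d≺d′ = d≺d′
  χ-pres : ∀ α a → χ (((A ⊕ B) ⊕ C) ⊕ D) α a ⇔ χ (A ⊕ ((B ⊕ C) ⊕ D)) α (regroup a)
  χ-pres α (inj₁ (inj₁ (inj₁ _))) = ⇔-id _
  χ-pres α (inj₁ (inj₁ (inj₂ _))) = ⇔-id _
  χ-pres α (inj₁ (inj₂ _))        = ⇔-id _
  χ-pres α (inj₂ _)               = ⇔-id _

regroup-surjective : {A B C D : Set} (z : A ⊎ ((B ⊎ C) ⊎ D)) → ∃ λ z′ → regroup {A} {B} {C} {D} z′ ≡ z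
regroup-surjective (inj₁ a)                = inj₁ (inj₁ (inj₁ a)) , refl
regroup-surjective (inj₂ (inj₁ (inj₁ b))) = inj₁ (inj₁ (inj₂ b)) , refl
regroup-surjective (inj₂ (inj₁ (inj₂ c))) = inj₁ (inj₂ c) , refl
regroup-surjective (inj₂ (inj₂ d))        = inj₂ d , refl

∅ : {Λ : Set} → CLO Λ
∅ = record
  { Carrier = ⊥ ; _≺_ = λ () ; χ = λ _ () ; irrefl = λ () ; trans = λ {x} → ⊥-elim x ; total = λ () }

module Windows {Λ : Set} (Y : CLO Λ) where

  -- window m is the sum of the copies of Y indexed by -m, …, m - 1.
  window : ℕ → CLO Λ
  window zero    = ∅
  window (suc m) = (Y ⊕ window m) ⊕ Y

  place : ∀ m → Carrier (window m) → Carrier (Σζ Y)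
  place (suc m) (inj₁ (inj₁ y)) = -[1+ m ] , y
  place (suc m) (inj₁ (inj₂ w)) = place m w
  place (suc m) (inj₂ y)        = + m , y

  place-bounds : ∀ m w → -[1+ m ] <ℤ proj₁ (place m w) × proj₁ (place m w) <ℤ + m
  place-bounds (suc m) (inj₁ (inj₁ _)) = -<- (ℕ.n<1+n m) , -<+
  place-bounds (suc m) (inj₁ (inj₂ w)) =
    let lower , upper = place-bounds m w
    in ℤ.<-trans (-<- (ℕ.n<1+n m)) lower , ℤ.<-trans upper (+<+ (ℕ.n<1+n m))
  place-bounds (suc m) (inj₂ _)        = -<+ , +<+ (ℕ.n<1+n m)

  place-mono : ∀ m {w w′} → _≺_ (window m) w w′ → _≺_ (Σζ Y) (place m w) (place m w′)
  place-mono (suc m) {inj₁ (inj₁ _)} {inj₁ (inj₁ _)} y≺y′ = inj₂ (refl , y≺y′)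
  place-mono (suc m) {inj₁ (inj₁ _)} {inj₁ (inj₂ w)} _    = inj₁ (proj₁ (place-bounds m w))
  place-mono (suc m) {inj₁ (inj₁ _)} {inj₂ _}        _    = inj₁ -<+
  place-mono (suc m) {inj₁ (inj₂ _)} {inj₁ (inj₂ _)} w≺w′ = place-mono m w≺w′
  place-mono (suc m) {inj₁ (inj₂ w)} {inj₂ _}        _    = inj₁ (proj₂ (place-bounds m w))
  place-mono (suc m) {inj₂ _}        {inj₂ _}        y≺y′ = inj₂ (refl , y≺y′)

  place-χ : ∀ m α w → χ (window m) α w ⇔ χ (Σζ Y) α (place m w)
  place-χ (suc m) α (inj₁ (inj₁ _)) = ⇔-id _
  place-χ (suc m) α (inj₁ (inj₂ w)) = place-χ m α w
  place-χ (suc m) α (inj₂ _)        = ⇔-id _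

  place-embedding : ∀ m → Embedding (window m) (Σζ Y)
  place-embedding m = record { to = place m ; mono = place-mono m ; χ-pres = place-χ m }

  shell : ℤ → ℕ
  shell (+ n)    = n
  shell -[1+ n ] = n

  place-onto : ∀ m i y → shell i < m → ∃ λ w → place m w ≡ (i , y)
  place-onto (suc m) (+ n) y n<1+m with ℕ.m<1+n⇒m<n∨m≡n n<1+m
  ... | inj₁ n<m  = let w , eq = place-onto m (+ n) y n<m in inj₁ (inj₂ w) , eq
  ... | inj₂ refl = inj₂ y , refl
  place-onto (suc m) -[1+ n ] y n<1+m with ℕ.m<1+n⇒m<n∨m≡n n<1+m
  ... | inj₁ n<m  = let w , eq = place-onto m -[1+ n ] y n<m in inj₁ (inj₂ w) , eq
  ... | inj₂ refl = inj₁ (inj₁ y) , refl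

-- Ehrenfeucht–Fraïssé games

module EF {Λ : Set} (L : List Λ) where

  record SameAtoms (M N : CLO Λ) {n : ℕ} (v : Assignment M n) (w : Assignment N n) : Set where
    constructor sameAtoms
    field
      ≡-agree : ∀ i j → LiftRel _≡_ (v i) (v j) ⇔ LiftRel _≡_ (w i) (w j)
      ≺-agree : ∀ i j → LiftRel (_≺_ M) (v i) (v j) ⇔ LiftRel (_≺_ N) (w i) (w j)
      χ-agree : ∀ {α} → α ∈ L → ∀ i → LiftPred (χ M α) (v i) ⇔ LiftPred (χ N α) (w i)
  open SameAtoms public

  Wins : (M N : CLO Λ) → ℕ → {n : ℕ} → Assignment M n → Assignment N n → Set
  Wins M N zero    v w = SameAtoms M N v w
  Wins M N (suc k) v w = SameAtoms M N v w
    × (∀ a → ∃ λ b → Wins M N k (just a ∷ₐ v) (just b ∷ₐ w))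
    × (∀ b → ∃ λ a → Wins M N k (just a ∷ₐ v) (just b ∷ₐ w))

  module _ {M N : CLO Λ} where

    Wins⇒SameAtoms : ∀ k {n} {v : Assignment M n} {w : Assignment N n} → Wins M N k v w → SameAtoms M N v w
    Wins⇒SameAtoms zero    g = g
    Wins⇒SameAtoms (suc k) g = proj₁ g

    Wins-pred : ∀ k {n} {v : Assignment M n} {w : Assignment N n} → Wins M N (suc k) v w → Wins M N k v w
    Wins-pred zero    (atoms , _) = atoms
    Wins-pred (suc k) (atoms , forth , back) =
      atoms
      , (λ a → let b , g = forth a in b , Wins-pred k g)
      , (λ b → let a , g = back b in a , Wins-pred k g)

    SameAtoms-reindex : ∀ {m n} (π : Fin m → Maybe (Fin n)) {v : Assignment M n} {w : Assignment N n} →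
      SameAtoms M N v w → SameAtoms M N (reindex π v) (reindex π w)
    SameAtoms-reindex π s = sameAtoms
      (λ i j → LiftRel-reindex (≡-agree s) (π i) (π j))
      (λ i j → LiftRel-reindex (≺-agree s) (π i) (π j))
      (λ α∈L i → LiftPred-reindex (χ-agree s α∈L) (π i))

  module _ {M : CLO Λ} where

    SameAtoms-≗ : ∀ {n} {v v′ : Assignment M n} → v ≗ v′ → SameAtoms M M v v′
    SameAtoms-≗ v≗v′ = sameAtoms
      (λ i j → ≡⇒⇔ (cong₂ (LiftRel _≡_) (v≗v′ i) (v≗v′ j)))
      (λ i j → ≡⇒⇔ (cong₂ (LiftRel (_≺_ M)) (v≗v′ i) (v≗v′ j)))
      (λ {α} _ i → ≡⇒⇔ (cong (LiftPred (χ M α)) (v≗v′ i)))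

    ≗⇒Wins : ∀ k {n} {v v′ : Assignment M n} → v ≗ v′ → Wins M M k v v′
    ≗⇒Wins zero    v≗v′ = SameAtoms-≗ v≗v′
    ≗⇒Wins (suc k) v≗v′ =
      SameAtoms-≗ v≗v′
      , (λ a → a , ≗⇒Wins k (just a ∷-≗ v≗v′))
      , (λ a → a , ≗⇒Wins k (just a ∷-≗ v≗v′))

  module _ {M N P : CLO Λ} where

    SameAtoms-trans : ∀ {n} {u : Assignment M n} {v : Assignment N n} {w : Assignment P n} →
      SameAtoms M N u v → SameAtoms N P v w → SameAtoms M P u w
    SameAtoms-trans s t = sameAtoms
      (λ i j → ⇔-trans (≡-agree s i j) (≡-agree t i j))
      (λ i j → ⇔-trans (≺-agree s i j) (≺-agree t i j))
      (λ α∈L i → ⇔-trans (χ-agree s α∈L i) (χ-agree t α∈L i))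

    Wins-trans : ∀ k {n} {u : Assignment M n} {v : Assignment N n} {w : Assignment P n} →
      Wins M N k u v → Wins N P k v w → Wins M P k u w
    Wins-trans zero g h = SameAtoms-trans g h
    Wins-trans (suc k) (s , forth , back) (t , forth′ , back′) =
      SameAtoms-trans s t
      , (λ a → let b , g = forth a ; c , h = forth′ b in c , Wins-trans k g h)
      , (λ c → let b , h = back′ c ; a , g = back b in a , Wins-trans k g h)

  module _ {M N : CLO Λ} where

    Wins-cong : ∀ k {n} {v v′ : Assignment M n} {w w′ : Assignment N n} →
      Wins M N k v w → v ≗ v′ → w ≗ w′ → Wins M N k v′ w′
    Wins-cong k g v≗v′ w≗w′ =
      Wins-trans k (≗⇒Wins k (sym ∘ v≗v′)) (Wins-trans k g (≗⇒Wins k w≗w′))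

    Wins-reindex : ∀ k {m n} (π : Fin m → Maybe (Fin n)) {v : Assignment M n} {w : Assignment N n} →
      Wins M N k v w → Wins M N k (reindex π v) (reindex π w)
    Wins-reindex zero    π g = SameAtoms-reindex π g
    Wins-reindex (suc k) π {v} {w} (s , forth , back) =
      SameAtoms-reindex π s
      , (λ a → let b , g = forth a in b , extend a b g)
      , (λ b → let a , g = back b in a , extend a b g)
      where
      extend : ∀ a b → Wins M N k (just a ∷ₐ v) (just b ∷ₐ w) →
        Wins M N k (just a ∷ₐ reindex π v) (just b ∷ₐ reindex π w)
      extend a b g = Wins-cong k (Wins-reindex k (lift π) g)
        (reindex-lift π (just a) v) (reindex-lift π (just b) w)

    Wins-undefined : ∀ k {n} {v : Assignment M n} {w : Assignment N n} →
      Wins M N k v w → Wins M N k (nothing ∷ₐ v) (nothing ∷ₐ w)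
    Wins-undefined k g = Wins-cong k (Wins-reindex k skip g) shifted shifted
      where
      skip : ∀ {n} → Fin (suc n) → Maybe (Fin n)
      skip zero    = nothing
      skip (suc i) = just i
      shifted : ∀ {A : Set} {n} {u : Fin n → Maybe A} → reindex skip u ≗ (nothing ∷ₐ u)
      shifted zero    = refl
      shifted (suc i) = refl

  module _ {M N : CLO Λ} (e : Embedding M N) where
    open Embedding e

    SameAtoms-embedding : ∀ {n} (v : Assignment M n) → SameAtoms M N v (mapᵐ to ∘ v)
    SameAtoms-embedding v = sameAtoms
      (λ i j → LiftRel-map (λ a b → mk⇔ (cong to) (injective a b)) (v i) (v j))
      (λ i j → LiftRel-map (λ a b → mk⇔ mono (reflects a b)) (v i) (v j))
      (λ {α} _ i → LiftPred-map (χ-pres α) (v i))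

    Wins-surjective : (∀ b → ∃ λ a → to a ≡ b) → ∀ k {n} (v : Assignment M n) → Wins M N k v (mapᵐ to ∘ v)
    Wins-surjective onto zero    v = SameAtoms-embedding v
    Wins-surjective onto (suc k) v =
      SameAtoms-embedding v
      , (λ a → to a , Wins-cong k (Wins-surjective onto k (just a ∷ₐ v)) (λ _ → refl) (∘-∷ₐ (mapᵐ to) (just a) v))
      , (λ b → let a , to-a≡b = onto b in
           a , Wins-cong k (Wins-surjective onto k (just a ∷ₐ v)) (λ _ → refl)
                 λ { zero → cong just to-a≡b ; (suc i) → refl })

  module _ {A B C D : CLO Λ} where

    ≡-⊕ : ∀ {x x′ y y′} → SameSide x y → SameSide x′ y′ →
      LiftRel _≡_ (x >>= isInj₁) (x′ >>= isInj₁) ⇔ LiftRel _≡_ (y >>= isInj₁) (y′ >>= isInj₁) →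
      LiftRel _≡_ (x >>= isInj₂) (x′ >>= isInj₂) ⇔ LiftRel _≡_ (y >>= isInj₂) (y′ >>= isInj₂) →
      LiftRel {Carrier A ⊎ Carrier C} _≡_ x x′ ⇔ LiftRel {Carrier B ⊎ Carrier D} _≡_ y y′
    ≡-⊕ undefined       _               _ _ = ⇔-id _
    ≡-⊕ (onLeft _ _)    undefined       _ _ = ⇔-id _
    ≡-⊕ (onRight _ _)   undefined       _ _ = ⇔-id _
    ≡-⊕ (onLeft _ _)    (onLeft _ _)    l _ =
      mk⇔ (cong inj₁ ∘ Equivalence.to l ∘ inj₁-injective) (cong inj₁ ∘ Equivalence.from l ∘ inj₁-injective)
    ≡-⊕ (onRight _ _)   (onRight _ _)   _ r =
      mk⇔ (cong inj₂ ∘ Equivalence.to r ∘ inj₂-injective) (cong inj₂ ∘ Equivalence.from r ∘ inj₂-injective)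
    ≡-⊕ (onLeft _ _)    (onRight _ _)   _ _ = mk⇔ (λ ()) (λ ())
    ≡-⊕ (onRight _ _)   (onLeft _ _)    _ _ = mk⇔ (λ ()) (λ ())

    ≺-⊕ : ∀ {x x′ y y′} → SameSide x y → SameSide x′ y′ →
      LiftRel (_≺_ A) (x >>= isInj₁) (x′ >>= isInj₁) ⇔ LiftRel (_≺_ B) (y >>= isInj₁) (y′ >>= isInj₁) →
      LiftRel (_≺_ C) (x >>= isInj₂) (x′ >>= isInj₂) ⇔ LiftRel (_≺_ D) (y >>= isInj₂) (y′ >>= isInj₂) →
      LiftRel (_≺_ (A ⊕ C)) x x′ ⇔ LiftRel (_≺_ (B ⊕ D)) y y′
    ≺-⊕ undefined       _               _ _ = ⇔-id _
    ≺-⊕ (onLeft _ _)    undefined       _ _ = ⇔-id _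
    ≺-⊕ (onRight _ _)   undefined       _ _ = ⇔-id _
    ≺-⊕ (onLeft _ _)    (onLeft _ _)    l _ = l
    ≺-⊕ (onRight _ _)   (onRight _ _)   _ r = r
    ≺-⊕ (onLeft _ _)    (onRight _ _)   _ _ = ⇔-id _
    ≺-⊕ (onRight _ _)   (onLeft _ _)    _ _ = ⇔-id _

    χ-⊕ : ∀ {α x y} → SameSide x y →
      LiftPred (χ A α) (x >>= isInj₁) ⇔ LiftPred (χ B α) (y >>= isInj₁) →
      LiftPred (χ C α) (x >>= isInj₂) ⇔ LiftPred (χ D α) (y >>= isInj₂) →
      LiftPred (χ (A ⊕ C) α) x ⇔ LiftPred (χ (B ⊕ D) α) y
    χ-⊕ undefined     _ _ = ⇔-id _
    χ-⊕ (onLeft _ _)  l _ = l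
    χ-⊕ (onRight _ _) _ r = r

    SameAtoms-⊕ : ∀ {n} {v : Assignment (A ⊕ C) n} {w : Assignment (B ⊕ D) n} →
      SameAtoms A B (left v) (left w) → SameAtoms C D (right v) (right w) → SameAtoms (A ⊕ C) (B ⊕ D) v w
    SameAtoms-⊕ {v = v} {w} sˡ sʳ = sameAtoms
      (λ i j → ≡-⊕ (side i) (side j) (≡-agree sˡ i j) (≡-agree sʳ i j))
      (λ i j → ≺-⊕ (side i) (side j) (≺-agree sˡ i j) (≺-agree sʳ i j))
      (λ α∈L i → χ-⊕ (side i) (χ-agree sˡ α∈L i) (χ-agree sʳ α∈L i))
      where
      side : ∀ i → SameSide (v i) (w i)
      side i = sameSide (v i) (w i) (≡-agree sˡ i i) (≡-agree sʳ i i)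

    Wins-⊕ : ∀ k {n} {v : Assignment (A ⊕ C) n} {w : Assignment (B ⊕ D) n} →
      Wins A B k (left v) (left w) → Wins C D k (right v) (right w) → Wins (A ⊕ C) (B ⊕ D) k v w
    Wins-⊕ zero    gˡ gʳ = SameAtoms-⊕ gˡ gʳ
    Wins-⊕ (suc k) {v = v} {w} gˡ@(sˡ , forthˡ , backˡ) gʳ@(sʳ , forthʳ , backʳ) =
      SameAtoms-⊕ sˡ sʳ , forth , back
      where
      extend : ∀ x y →
        Wins A B k ((just x >>= isInj₁) ∷ₐ left v) ((just y >>= isInj₁) ∷ₐ left w) →
        Wins C D k ((just x >>= isInj₂) ∷ₐ right v) ((just y >>= isInj₂) ∷ₐ right w) →
        Wins (A ⊕ C) (B ⊕ D) k (just x ∷ₐ v) (just y ∷ₐ w)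
      extend x y hˡ hʳ = Wins-⊕ k
        (Wins-cong k hˡ (sym ∘ ∘-∷ₐ (_>>= isInj₁) (just x) v) (sym ∘ ∘-∷ₐ (_>>= isInj₁) (just y) w))
        (Wins-cong k hʳ (sym ∘ ∘-∷ₐ (_>>= isInj₂) (just x) v) (sym ∘ ∘-∷ₐ (_>>= isInj₂) (just y) w))
      forth : ∀ x → ∃ λ y → Wins (A ⊕ C) (B ⊕ D) k (just x ∷ₐ v) (just y ∷ₐ w)
      forth (inj₁ a) = let b , h = forthˡ a in inj₁ b , extend (inj₁ a) (inj₁ b) h (Wins-undefined k (Wins-pred k gʳ))
      forth (inj₂ c) = let d , h = forthʳ c in inj₂ d , extend (inj₂ c) (inj₂ d) (Wins-undefined k (Wins-pred k gˡ)) h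
      back : ∀ y → ∃ λ x → Wins (A ⊕ C) (B ⊕ D) k (just x ∷ₐ v) (just y ∷ₐ w)
      back (inj₁ b) = let a , h = backˡ b in inj₁ a , extend (inj₁ a) (inj₁ b) h (Wins-undefined k (Wins-pred k gʳ))
      back (inj₂ d) = let c , h = backʳ d in inj₂ c , extend (inj₂ c) (inj₂ d) (Wins-undefined k (Wins-pred k gˡ)) h

  module _ {A B C : CLO Λ} where

    Wins-⊕-map₁ : ∀ k {f : Carrier A → Carrier B} →
      (∀ {n} (u : Assignment A n) → Wins A B k u (mapᵐ f ∘ u)) →
      ∀ {n} (v : Assignment (A ⊕ C) n) → Wins (A ⊕ C) (B ⊕ C) k v (mapᵐ (map₁ f) ∘ v)
    Wins-⊕-map₁ k {f} g v = Wins-⊕ k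
      (Wins-cong k (g (left v)) (λ _ → refl) (sym ∘ left-map₁ ∘ v))
      (≗⇒Wins k (sym ∘ right-map₁ ∘ v))
      where
      left-map₁ : ∀ x → (mapᵐ (map₁ f) x >>= isInj₁) ≡ mapᵐ f (x >>= isInj₁)
      left-map₁ nothing         = refl
      left-map₁ (just (inj₁ _)) = refl
      left-map₁ (just (inj₂ _)) = refl
      right-map₁ : ∀ x → (mapᵐ (map₁ f) x >>= isInj₂) ≡ (x >>= isInj₂)
      right-map₁ nothing         = refl
      right-map₁ (just (inj₁ _)) = refl
      right-map₁ (just (inj₂ _)) = refl

    Wins-inj₁ : ∀ k {n} {v : Assignment A n} {w : Assignment B n} →
      Wins A B k v w → Wins (A ⊕ C) (B ⊕ C) k (mapᵐ inj₁ ∘ v) (mapᵐ inj₁ ∘ w)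
    Wins-inj₁ k {v = v} {w} g = Wins-⊕ k
      (Wins-cong k g (sym ∘ left-inj₁ ∘ v) (sym ∘ left-inj₁ ∘ w))
      (≗⇒Wins k (λ i → ≡-trans (right-inj₁ (v i)) (sym (right-inj₁ (w i)))))
      where
      left-inj₁ : {E : Set} (x : Maybe E) → (mapᵐ inj₁ x >>= isInj₁ {B = Carrier C}) ≡ x
      left-inj₁ nothing  = refl
      left-inj₁ (just _) = refl
      right-inj₁ : {E : Set} (x : Maybe E) → (mapᵐ inj₁ x >>= isInj₂ {B = Carrier C}) ≡ nothing
      right-inj₁ nothing  = refl
      right-inj₁ (just _) = refl

  module _ {M N : CLO Λ} where

    Wins-just-∷ : ∀ k {n} {ρ : Fin n → Carrier M} {σ : Fin n → Carrier N} {a b} →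
      Wins M N k (just a ∷ₐ (just ∘ ρ)) (just b ∷ₐ (just ∘ σ)) → Wins M N k (just ∘ (a ∷ₐ ρ)) (just ∘ (b ∷ₐ σ))
    Wins-just-∷ k {ρ = ρ} {σ} {a} {b} g = Wins-cong k g (sym ∘ ∘-∷ₐ just a ρ) (sym ∘ ∘-∷ₐ just b σ)

    Wins⇒Sat⇔ : ∀ k {n} (φ : Formula Λ n) → quantifierDepth φ ≤ k → colours φ ⊆ L →
      (ρ : Fin n → Carrier M) (σ : Fin n → Carrier N) →
      Wins M N k (just ∘ ρ) (just ∘ σ) → Sat M φ ρ ⇔ Sat N φ σ
    Wins⇒Sat⇔ k (i ≐ j)   _ _   ρ σ g = ≡-agree (Wins⇒SameAtoms k g) i j
    Wins⇒Sat⇔ k (i ≺' j)  _ _   ρ σ g = ≺-agree (Wins⇒SameAtoms k g) i j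
    Wins⇒Sat⇔ k (col α i) _ c⊆L ρ σ g = χ-agree (Wins⇒SameAtoms k g) (c⊆L (here refl)) i
    Wins⇒Sat⇔ k ⊥'        _ _   ρ σ g = ⇔-id _
    Wins⇒Sat⇔ k (¬' φ)    d c⊆L ρ σ g = ¬-cong-⇔ (Wins⇒Sat⇔ k φ d c⊆L ρ σ g)
    Wins⇒Sat⇔ k (φ ∧' ψ)  d c⊆L ρ σ g =
      Wins⇒Sat⇔ k φ (ℕ.m⊔n≤o⇒m≤o _ _ d) (c⊆L ∘ ∈-++⁺ˡ) ρ σ g
      ×-⇔ Wins⇒Sat⇔ k ψ (ℕ.m⊔n≤o⇒n≤o _ _ d) (c⊆L ∘ ∈-++⁺ʳ (colours φ)) ρ σ g
    Wins⇒Sat⇔ k (φ ∨' ψ)  d c⊆L ρ σ g =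
      Wins⇒Sat⇔ k φ (ℕ.m⊔n≤o⇒m≤o _ _ d) (c⊆L ∘ ∈-++⁺ˡ) ρ σ g
      ⊎-⇔ Wins⇒Sat⇔ k ψ (ℕ.m⊔n≤o⇒n≤o _ _ d) (c⊆L ∘ ∈-++⁺ʳ (colours φ)) ρ σ g
    Wins⇒Sat⇔ k (φ ⇒' ψ)  d c⊆L ρ σ g = →-cong-⇔
      (Wins⇒Sat⇔ k φ (ℕ.m⊔n≤o⇒m≤o _ _ d) (c⊆L ∘ ∈-++⁺ˡ) ρ σ g)
      (Wins⇒Sat⇔ k ψ (ℕ.m⊔n≤o⇒n≤o _ _ d) (c⊆L ∘ ∈-++⁺ʳ (colours φ)) ρ σ g)
    Wins⇒Sat⇔ (suc k) (∀' φ) (s≤s d) c⊆L ρ σ (_ , forth , back) = mk⇔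
      (λ s b → let a , g = back b in Equivalence.to (step a b g) (s a))
      (λ s a → let b , g = forth a in Equivalence.from (step a b g) (s b))
      where
      step : ∀ a b → Wins M N k (just a ∷ₐ (just ∘ ρ)) (just b ∷ₐ (just ∘ σ)) → Sat M φ (a ∷ₐ ρ) ⇔ Sat N φ (b ∷ₐ σ)
      step a b g = Wins⇒Sat⇔ k φ d c⊆L (a ∷ₐ ρ) (b ∷ₐ σ) (Wins-just-∷ k g)
    Wins⇒Sat⇔ (suc k) (∃' φ) (s≤s d) c⊆L ρ σ (_ , forth , back) = mk⇔
      (λ (a , s) → let b , g = forth a in b , Equivalence.to (step a b g) s)
      (λ (b , s) → let a , g = back b in a , Equivalence.from (step a b g) s)
      where
      step : ∀ a b → Wins M N k (just a ∷ₐ (just ∘ ρ)) (just b ∷ₐ (just ∘ σ)) → Sat M φ (a ∷ₐ ρ) ⇔ Sat N φ (b ∷ₐ σ)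
      step a b g = Wins⇒Sat⇔ k φ d c⊆L (a ∷ₐ ρ) (b ∷ₐ σ) (Wins-just-∷ k g)

  -- Hintikka formulas

  allPairs : ∀ n → List (Fin n × Fin n)
  allPairs n = cartesianProduct (allFin n) (allFin n)

  atomicFormulas : ∀ n → List (Formula Λ n)
  atomicFormulas n =
    map (uncurry _≐_) (allPairs n) ++ (map (uncurry _≺'_) (allPairs n) ++ map (uncurry col) (cartesianProduct L (allFin n)))

  SameAtoms-fromAtomic : ∀ {M N : CLO Λ} {n} {ρ : Fin n → Carrier M} {σ : Fin n → Carrier N} →
    (∀ {φ} → φ ∈ atomicFormulas n → Sat M φ ρ ⇔ Sat N φ σ) → SameAtoms M N (just ∘ ρ) (just ∘ σ)
  SameAtoms-fromAtomic {n = n} agree = sameAtoms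
    (λ i j → agree (∈-++⁺ˡ (∈-map⁺ (uncurry _≐_) (∈-cartesianProduct⁺ (∈-allFin i) (∈-allFin j)))))
    (λ i j → agree (∈-++⁺ʳ (map (uncurry _≐_) (allPairs n))
      (∈-++⁺ˡ (∈-map⁺ (uncurry _≺'_) (∈-cartesianProduct⁺ (∈-allFin i) (∈-allFin j))))))
    (λ α∈L i → agree (∈-++⁺ʳ (map (uncurry _≐_) (allPairs n)) (∈-++⁺ʳ (map (uncurry _≺'_) (allPairs n))
      (∈-map⁺ (uncurry col) (∈-cartesianProduct⁺ α∈L (∈-allFin i))))))

  hintikkaSucc : ∀ {n} → Formula Λ n × List (Formula Λ (suc n)) → Formula Λ n
  hintikkaSucc (c , S) = c ∧' (⋀ (map ∃' S) ∧' ∀' (⋁ S))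

  hintikka : ℕ → ∀ n → List (Formula Λ n)
  hintikka zero    n = completeConjunctions (atomicFormulas n)
  hintikka (suc k) n =
    map hintikkaSucc (cartesianProduct (completeConjunctions (atomicFormulas n)) (sublists (hintikka k (suc n))))

  hintikka-agree⇒Wins : ∀ {M N : CLO Λ} k {n} {ψ} → ψ ∈ hintikka k n →
    (ρ : Fin n → Carrier M) (σ : Fin n → Carrier N) → Sat M ψ ρ → Sat N ψ σ → Wins M N k (just ∘ ρ) (just ∘ σ)
  hintikka-agree⇒Wins zero {n} ψ∈ ρ σ s t =
    SameAtoms-fromAtomic (completeConjunction-agree (atomicFormulas n) ψ∈ s t)
  hintikka-agree⇒Wins {M} {N} (suc k) {n} ψ∈ ρ σ s t with ∈-map⁻ hintikkaSucc ψ∈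
  ... | (c , S) , cS∈ , refl
    with ∈-cartesianProduct⁻ (completeConjunctions (atomicFormulas n)) (sublists (hintikka k (suc n))) cS∈
  ... | c∈ , S∈ =
    SameAtoms-fromAtomic (completeConjunction-agree (atomicFormulas n) c∈ (proj₁ s) (proj₁ t)) , forth , back
    where
    step : ∀ {θ} a b → θ ∈ S → Sat M θ (a ∷ₐ ρ) → Sat N θ (b ∷ₐ σ) →
      Wins M N k (just a ∷ₐ (just ∘ ρ)) (just b ∷ₐ (just ∘ σ))
    step a b θ∈S sθ tθ = Wins-cong k (hintikka-agree⇒Wins k (∈-sublists⇒⊆ S∈ θ∈S) (a ∷ₐ ρ) (b ∷ₐ σ) sθ tθ)
      (∘-∷ₐ just a ρ) (∘-∷ₐ just b σ)
    forth : ∀ a → ∃ λ b → Wins M N k (just a ∷ₐ (just ∘ ρ)) (just b ∷ₐ (just ∘ σ))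
    forth a =
      let θ , θ∈S , sθ = ⋁-elim S (proj₂ (proj₂ s) a)
          b , tθ = ⋀-elim (proj₁ (proj₂ t)) (∈-map⁺ ∃' θ∈S)
      in b , step a b θ∈S sθ tθ
    back : ∀ b → ∃ λ a → Wins M N k (just a ∷ₐ (just ∘ ρ)) (just b ∷ₐ (just ∘ σ))
    back b =
      let θ , θ∈S , tθ = ⋁-elim S (proj₂ (proj₂ t) b)
          a , sθ = ⋀-elim (proj₁ (proj₂ s)) (∈-map⁺ ∃' θ∈S)
      in a , step a b θ∈S sθ tθ

  module _ (lem : ExcludedMiddle 0ℓ) where

    hintikka-exists : ∀ {M : CLO Λ} k {n} (ρ : Fin n → Carrier M) → ∃ λ ψ → ψ ∈ hintikka k n × Sat M ψ ρ
    hintikka-exists zero {n} ρ = completeConjunction-exists lem (atomicFormulas n)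
    hintikka-exists {M} (suc k) {n} ρ with completeConjunction-exists lem (atomicFormulas n)
    ... | c , c∈ , sc =
      hintikkaSucc (c , S)
      , ∈-map⁺ hintikkaSucc (∈-cartesianProduct⁺ c∈ (filter∈sublists realised? (hintikka k (suc n))))
      , sc , ⋀-intro (map ∃' S) realised , covered
      where
      realised? : Decidable (λ θ → ∃ λ a → Sat M θ (a ∷ₐ ρ))
      realised? _ = lem
      S : List (Formula Λ (suc n))
      S = filter realised? (hintikka k (suc n))
      realised : ∀ {φ} → φ ∈ map ∃' S → Sat M φ ρ
      realised φ∈ with ∈-map⁻ ∃' φ∈
      ... | θ , θ∈S , refl = proj₂ (∈-filter⁻ realised? {xs = hintikka k (suc n)} θ∈S)
      covered : ∀ a → Sat M (⋁ S) (a ∷ₐ ρ)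
      covered a =
        let θ , θ∈ , sθ = hintikka-exists k (a ∷ₐ ρ)
        in ⋁-intro (∈-filter⁺ realised? θ∈ (a , sθ)) sθ

    Elementary⇒Wins : ∀ {M N : CLO Λ} {f : Carrier M → Carrier N} → Elementary M N f →
      ∀ k {n} (ρ : Fin n → Carrier M) → Wins M N k (just ∘ ρ) (just ∘ f ∘ ρ)
    Elementary⇒Wins {f = f} elem k ρ =
      let ψ , ψ∈ , s = hintikka-exists k ρ
      in hintikka-agree⇒Wins k ψ∈ ρ (f ∘ ρ) s (proj₁ (elem ψ ρ) s)

    -- Undefined entries are filled with an arbitrary a₀ and then dropped again by reindexing.
    Elementary⇒Wins-partial : ∀ {M N : CLO Λ} {f : Carrier M → Carrier N} → Carrier M → Elementary M N f →
      ∀ k {n} (v : Assignment M n) → Wins M N k v (mapᵐ f ∘ v)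
    Elementary⇒Wins-partial {M} {f = f} a₀ elem k {n} v =
      Wins-cong k (Wins-reindex k definedAt (Elementary⇒Wins {f = f} elem k ρ)) restrictˡ restrictʳ
      where
      ρ : Fin n → Carrier M
      ρ = fromMaybe a₀ ∘ v
      definedAt : Fin n → Maybe (Fin n)
      definedAt i = mapᵐ (λ _ → i) (v i)
      restrictˡ : reindex definedAt (just ∘ ρ) ≗ v
      restrictˡ i with v i in eq
      ... | nothing = refl
      ... | just _  = cong (just ∘ fromMaybe a₀) eq
      restrictʳ : reindex definedAt (just ∘ f ∘ ρ) ≗ mapᵐ f ∘ v
      restrictʳ i with v i in eq
      ... | nothing = refl
      ... | just _  = cong (just ∘ f ∘ fromMaybe a₀) eq

-- The sum of ζ copies

module Sumζ (lem : ExcludedMiddle 0ℓ) {Λ : Set} (X Y : CLO Λ) (y₀ : Carrier Y)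
         (X≼X⊕Y : Elementary X (X ⊕ Y) inj₁) (L : List Λ) where
  open EF L
  open Windows Y

  -- ∃x. x = x holds in X ⊕ Y, hence in X.
  x₀ : Carrier X
  x₀ = proj₁ (proj₂ (X≼X⊕Y {0} (∃' (zero ≐ zero)) (λ ())) (inj₂ y₀ , refl))

  Wins-X⊕Y : ∀ k {n} (v : Assignment X n) → Wins X (X ⊕ Y) k v (mapᵐ inj₁ ∘ v)
  Wins-X⊕Y = Elementary⇒Wins-partial lem x₀ X≼X⊕Y

  widen : ∀ m → Carrier (X ⊕ window m) → Carrier (X ⊕ window (suc m))
  widen m = map₂ (inj₁ ∘ inj₂)

  -- X ⊕ window (suc m) is ((X ⊕ Y) ⊕ window m) ⊕ Y regrouped; both new copies of Y are absorbed by X ≼ X ⊕ Y.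
  Wins-widen : ∀ k m {n} {a : Assignment X n} {c : Assignment (X ⊕ window m) n} →
    Wins X (X ⊕ window m) k a c → Wins X (X ⊕ window (suc m)) k a (mapᵐ (widen m) ∘ c)
  Wins-widen k m {a = a} {c} g = Wins-cong k regrouped (λ _ → refl) regroup-widen
    where
    inserted : Wins X (((X ⊕ Y) ⊕ window m) ⊕ Y) k a (mapᵐ inj₁ ∘ mapᵐ (map₁ inj₁) ∘ c)
    inserted = Wins-trans k (Wins-X⊕Y k a) (Wins-inj₁ k (Wins-trans k g (Wins-⊕-map₁ k (Wins-X⊕Y k) c)))
    regrouped : Wins X (X ⊕ window (suc m)) k a (mapᵐ regroup ∘ mapᵐ inj₁ ∘ mapᵐ (map₁ inj₁) ∘ c)
    regrouped = Wins-trans k inserted (Wins-surjective regroup-embedding regroup-surjective k _)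
    regroup-widen : mapᵐ regroup ∘ mapᵐ inj₁ ∘ mapᵐ (map₁ inj₁) ∘ c ≗ mapᵐ (widen m) ∘ c
    regroup-widen i with c i
    ... | nothing       = refl
    ... | just (inj₁ _) = refl
    ... | just (inj₂ _) = refl

  toΣζ : ∀ m → Carrier (X ⊕ window m) → Carrier (X ⊕ Σζ Y)
  toΣζ m = map₂ (place m)

  toΣζ-widen : ∀ m (z : Maybe (Carrier (X ⊕ window m))) → mapᵐ (toΣζ m) z ≡ mapᵐ (toΣζ (suc m)) (mapᵐ (widen m) z)
  toΣζ-widen m nothing         = refl
  toΣζ-widen m (just (inj₁ _)) = refl
  toΣζ-widen m (just (inj₂ _)) = refl

  copiesNeeded : Carrier (X ⊕ Σζ Y) → ℕ
  copiesNeeded (inj₁ _)       = 0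
  copiesNeeded (inj₂ (i , _)) = suc (shell i)

  toΣζ-onto : ∀ m z → copiesNeeded z ≤ m → ∃ λ z′ → toΣζ m z′ ≡ z
  toΣζ-onto m (inj₁ x)       _     = inj₁ x , refl
  toΣζ-onto m (inj₂ (i , y)) i<m = let w , eq = place-onto m i y i<m in inj₂ w , cong inj₂ eq

  -- A position in X versus X ⊕ Σζ Y that is the image of a winning position against a finite window.
  record Realisation (k : ℕ) {n : ℕ} (a : Assignment X n) (b : Assignment (X ⊕ Σζ Y) n) : Set where
    field
      size   : ℕ
      inner  : Assignment (X ⊕ window size) n
      images : b ≗ mapᵐ (toΣζ size) ∘ inner
      wins   : Wins X (X ⊕ window size) k a inner
  open Realisation

  module _ {k n : ℕ} {a : Assignment X n} {b : Assignment (X ⊕ Σζ Y) n} where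

    Realisation-widen : Realisation k a b → Realisation k a b
    Realisation-widen r = record
      { size   = suc (size r)
      ; inner  = mapᵐ (widen (size r)) ∘ inner r
      ; images = λ i → ≡-trans (images r i) (toΣζ-widen (size r) (inner r i))
      ; wins   = Wins-widen k (size r) (wins r)
      }

    Realisation-widenBy : ℕ → Realisation k a b → Realisation k a b
    Realisation-widenBy zero    r = r
    Realisation-widenBy (suc d) r = Realisation-widen (Realisation-widenBy d r)

    d≤size-widenBy : ∀ d r → d ≤ size (Realisation-widenBy d r)
    d≤size-widenBy zero    r = z≤n
    d≤size-widenBy (suc d) r = s≤s (d≤size-widenBy d r)

  Realisation⇒SameAtoms : ∀ k {n} {a : Assignment X n} {b} → Realisation k a b → SameAtoms X (X ⊕ Σζ Y) a b
  Realisation⇒SameAtoms k r = SameAtoms-trans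
    (SameAtoms-trans (Wins⇒SameAtoms k (wins r)) (SameAtoms-embedding (⊕-embeddingʳ (place-embedding (size r))) (inner r)))
    (SameAtoms-≗ (sym ∘ images r))

  Realisation-∷ : ∀ {j k n} {a : Assignment X n} {b} (r : Realisation j a b) {x z z′} → toΣζ (size r) z′ ≡ z →
    Wins X (X ⊕ window (size r)) k (just x ∷ₐ a) (just z′ ∷ₐ inner r) → Realisation k (just x ∷ₐ a) (just z ∷ₐ b)
  Realisation-∷ r z′↦z g = record
    { size   = size r
    ; inner  = just _ ∷ₐ inner r
    ; images = λ { zero → cong just (sym z′↦z) ; (suc i) → images r i }
    ; wins   = g
    }

  Realisation⇒Wins : ∀ k {n} {a : Assignment X n} {b} → Realisation k a b → Wins X (X ⊕ Σζ Y) k a b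
  Realisation⇒Wins zero    r = Realisation⇒SameAtoms zero r
  Realisation⇒Wins (suc k) r = Realisation⇒SameAtoms (suc k) r , forth , back
    where
    forth : ∀ x → ∃ λ z → Wins X (X ⊕ Σζ Y) k (just x ∷ₐ _) (just z ∷ₐ _)
    forth x = let z′ , g = proj₁ (proj₂ (wins r)) x in toΣζ (size r) z′ , Realisation⇒Wins k (Realisation-∷ r refl g)
    -- Before answering a move in copy i, widen the window until it contains that copy.
    back : ∀ z → ∃ λ x → Wins X (X ⊕ Σζ Y) k (just x ∷ₐ _) (just z ∷ₐ _)
    back z =
      let r′ = Realisation-widenBy (copiesNeeded z) r
          z′ , z′↦z = toΣζ-onto (size r′) z (d≤size-widenBy (copiesNeeded z) r)
          x , g = proj₂ (proj₂ (wins r′)) z′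
      in x , Realisation⇒Wins k (Realisation-∷ r′ z′↦z g)

  start : ∀ k {n} (ρ : Fin n → Carrier X) → Realisation k (just ∘ ρ) (just ∘ inj₁ ∘ ρ)
  start k ρ = record
    { size   = 0
    ; inner  = just ∘ inj₁ ∘ ρ
    ; images = λ _ → refl
    ; wins   = Wins-surjective inj₁-embedding onto k (just ∘ ρ)
    }
    where
    onto : ∀ z → ∃ λ x → inj₁ x ≡ z
    onto (inj₁ x) = x , refl
    onto (inj₂ ())

  Wins-X⊕Σζ : ∀ k {n} (ρ : Fin n → Carrier X) → Wins X (X ⊕ Σζ Y) k (just ∘ ρ) (just ∘ inj₁ ∘ ρ)
  Wins-X⊕Σζ k ρ = Realisation⇒Wins k (start k ρ)

lemma5p3 : ExcludedMiddle 0ℓ → {Λ : Set} (X Y : CLO Λ) → Carrier Y →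
    Elementary X (X ⊕ Y) inj₁ → Elementary X (X ⊕ Σζ Y) inj₁
lemma5p3 lem X Y y₀ X≼X⊕Y φ ρ = Equivalence.to sat⇔ , Equivalence.from sat⇔
  where
  open Sumζ lem X Y y₀ X≼X⊕Y (colours φ)
  open EF (colours φ)
  sat⇔ : Sat X φ ρ ⇔ Sat (X ⊕ Σζ Y) φ (inj₁ ∘ ρ)
  sat⇔ = Wins⇒Sat⇔ (quantifierDepth φ) φ ℕ.≤-refl ⊆-refl ρ (inj₁ ∘ ρ) (Wins-X⊕Σζ (quantifierDepth φ) ρ)
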